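{- For all integers $n\geq 2$ and $1\leq k\leq\binom{n}{2}$, with $N=\binom{n}{2}$, $$M(k,n)\leq M^{\mathsf{L}}(k,N)<\sqrt{2kN}<\sqrt{k}\,n.$$
   Context: For a finite graph $G$, $\mathrm{Mad}(G)=\max\{2e(H)/|V(H)| : H\subseteq G,\ |V(H)|\geq 1\}$ ($0$ if edgeless). $M(k,n)$ is the maximum of $\sum_{i=1}^k\mathrm{Mad}(G_i)$ over all partitions of $E(K_n)$ into $k$ spanning subgraphs. $M^{\mathsf{L}}(k,N)$ is the maximum of $\sum_{j=1}^k\mathrm{Mad}(G_j)$ over all multisets $\{G_1,\dots,G_k\}$ of $k$ finite graphs (repetitions allowed) with $\sum_j e(G_j)=N$. -}

module Defs where

open import Data.Nat as ℕ using (ℕ; zero; suc; _<ᵇ_)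
open import Data.Bool using (Bool; true; false; if_then_else_; _∧_)
open import Data.Fin using (Fin; toℕ) renaming (zero to fzero; suc to fsuc)
open import Data.Fin.Subset using (Subset; _∈_; ∣_∣)
open import Data.List using (List; map; allFin)
open import Data.Nat.ListAction using (sum)
open import Data.Integer using (+_)
open import Data.Rational using (ℚ; _/_; 0ℚ; _+_; _*_; _≤_; _<_)
open import Data.Product using (Σ; _×_; _,_; proj₁; proj₂)
open import Data.Sum using (_⊎_)
open import Relation.Binary.PropositionalEquality using (_≡_; _≢_)

record Graph (v : ℕ) : Set where
  field
    adj    : Fin v → Fin v → Bool
    sym    : ∀ i j → adj i j ≡ adj j i
    irrefl : ∀ i → adj i i ≡ false
open Graph public

AnyGraph : Set
AnyGraph = Σ ℕ Graph

sumFin : (v : ℕ) → (Fin v → ℕ) → ℕ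
sumFin v f = sum (map f (allFin v))

e : ∀ {v} → Graph v → ℕ
e {v} G = sumFin v λ i → sumFin v λ j →
  if adj G i j ∧ (toℕ i <ᵇ toℕ j) then 1 else 0

IsSubgraph : ∀ {v} → Graph v → Subset v → Graph v → Set
IsSubgraph {v} G S H = ∀ (i j : Fin v) → adj H i j ≡ true →
  (adj G i j ≡ true) × (i ∈ S) × (j ∈ S)

-- 2 e / s as a rational (only used with s ≥ 1)
dens : ℕ → ℕ → ℚ
dens ed zero    = 0ℚ
dens ed (suc s) = (+ (2 ℕ.* ed)) / suc s

-- m is Mad(G): the maximum of 2e(H)/|V(H)| over subgraphs with ≥ 1 vertex,
-- and 0 if G is edgeless (covers the empty graph)
IsMad : ∀ {v} → Graph v → ℚ → Set
IsMad {v} G m =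
  (∀ (S : Subset v) (H : Graph v) → IsSubgraph G S H → 1 ℕ.≤ ∣ S ∣ →
     dens (e H) ∣ S ∣ ≤ m)
  × ((Σ (Subset v) λ S → Σ (Graph v) λ H →
        IsSubgraph G S H × (1 ℕ.≤ ∣ S ∣) × (m ≡ dens (e H) ∣ S ∣))
     ⊎ ((e G ≡ 0) × (m ≡ 0ℚ)))

sumQ : (k : ℕ) → (Fin k → ℚ) → ℚ
sumQ zero    f = 0ℚ
sumQ (suc k) f = f fzero + sumQ k (λ j → f (fsuc j))

IsMadSum : (k : ℕ) → (Fin k → AnyGraph) → ℚ → Set
IsMadSum k Gs s = Σ (Fin k → ℚ) λ ms →
  (∀ j → IsMad (proj₂ (Gs j)) (ms j)) × (s ≡ sumQ k ms)

IsPartitionKn : (k n : ℕ) → (Fin k → Graph n) → Set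
IsPartitionKn k n Gs = ∀ (i j : Fin n) → i ≢ j →
  (Σ (Fin k) λ c → adj (Gs c) i j ≡ true)
  × (∀ c c' → adj (Gs c) i j ≡ true → adj (Gs c') i j ≡ true → c ≡ c')

asAny : ∀ {k n} → (Fin k → Graph n) → Fin k → AnyGraph
asAny {n = n} Gs j = n , Gs j

IsM : ℕ → ℕ → ℚ → Set
IsM k n m =
  (Σ (Fin k → Graph n) λ Gs → IsPartitionKn k n Gs × IsMadSum k (asAny Gs) m)
  × (∀ (Gs : Fin k → Graph n) s → IsPartitionKn k n Gs →
       IsMadSum k (asAny Gs) s → s ≤ m)

IsML : ℕ → ℕ → ℚ → Set
IsML k N m =
  (Σ (Fin k → AnyGraph) λ Gs → (sumFin k (λ j → e (proj₂ (Gs j))) ≡ N) × IsMadSum k Gs m)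
  × (∀ (Gs : Fin k → AnyGraph) s → sumFin k (λ j → e (proj₂ (Gs j))) ≡ N →
       IsMadSum k Gs s → s ≤ m)

-- x < √a  (a ≥ 0 natural), stated without reals
LtSqrt : ℚ → ℕ → Set
LtSqrt x a = (x < 0ℚ) ⊎ (x * x < ((+ a) / 1))

-- If Mad(G) = m is attained by a subgraph with a edges on s vertices, then a ≤ e(G) and
-- a ≤ C(s,2), so m (m + 1) ≤ 2 e(G).  For graphs G₁ … Gₖ with N edges in total,
-- Cauchy–Schwarz then gives (Σ mⱼ)² ≤ k Σ mⱼ² ≤ k (2N - Σ mⱼ), hence (Σ mⱼ)² < 2kN.
-- The colex graph with E edges contains, for every s, a subgraph on s vertices with
-- min(E, C(s,2)) edges, so it has the largest Mad among graphs with E edges.  Hence Mᴸ(k,N) is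
-- a maximum over the finitely many compositions of N into k parts, M(k,n) is a maximum over
-- the finitely many k-colourings of E(Kₙ), and M ≤ Mᴸ because a partition of E(Kₙ) is a
-- family of k graphs with C(n,2) edges.

module Submission where

open import Defs
open import Data.Nat using (ℕ; _≤_; _<_; _*_)
open import Data.Nat.Combinatorics using (_C_)
open import Data.Product using (Σ; _×_)
open import Data.Rational using (ℚ)
import Data.Rational as ℚ

open import Algebra.Bundles using (CommutativeRing)
import Algebra.Properties.Semiring.Sum as SemiringSum
open import Data.Bool using (Bool; true; false; if_then_else_; _∧_)
import Data.Bool.Properties as Bool
open import Data.Empty using (⊥-elim)
open import Data.Fin as Fin using (Fin; toℕ) renaming (zero to fzero; suc to fsuc)
import Data.Fin.Properties as Fin
open import Data.Fin.Subset using (Subset; ∣_∣; ⊤) renaming (_∈_ to _∈ˢ_)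
open import Data.Fin.Subset.Properties using (∣⊤∣≡n)
import Data.Integer as ℤ
import Data.Integer.Properties as ℤ
open import Data.List as List using (List; tabulate; filter)
import Data.List.Extrema
open import Data.List.Membership.Propositional using (_∈_)
open import Data.List.Membership.Propositional.Properties
  using (∈-filter⁺; ∈-cartesianProductWith⁺; ∈-allFin)
import Data.List.Relation.Unary.All as All
open import Data.List.Relation.Unary.All.Properties using (all-filter)
open import Data.List.Relation.Unary.Any using (here; there)
open import Data.Nat as ℕ using (zero; suc; _+_; _∸_; _⊓_; _<ᵇ_; z≤n; s≤s)
import Data.Nat.Combinatorics as ℕ
open import Data.Nat.ListAction using (sum)
import Data.Nat.Properties as ℕ
open import Data.Nat.Tactic.RingSolver using (solve-∀)
open import Data.Product using (_,_; proj₁; proj₂)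
import Data.Rational.Properties as ℚ
open import Data.Rational.Solver using (module +-*-Solver)
import Data.Rational.Unnormalised as ℚᵘ
import Data.Rational.Unnormalised.Properties as ℚᵘ
open import Data.Sum using (inj₁; inj₂)
open import Data.Vec as Vec using (Vec; []; _∷_; lookup)
import Data.Vec.Properties as Vec
open import Function using (_∘_; id; Equivalence)
open import Relation.Binary.Bundles using (DecTotalOrder)
open import Relation.Binary.Definitions using (tri<; tri≈; tri>)
open import Relation.Binary.PropositionalEquality as ≡ hiding (sym)
open import Relation.Nullary.Decidable using (does; yes; no; dec-true)
open import Relation.Nullary.Reflects using (ofʸ; ofⁿ)
open import Relation.Unary using (Decidable)
open import Relation.Unary.Properties using (U?)

module ℕΣ = SemiringSum ℕ.+-*-semiring
module ℚΣ = SemiringSum (CommutativeRing.semiring ℚ.+-*-commutativeRing)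

-- Finite sums and rational arithmetic

sum-map-tabulate : ∀ {A : Set} n (f : A → ℕ) (g : Fin n → A) →
                   sum (List.map f (tabulate g)) ≡ ℕΣ.sum (f ∘ g)
sum-map-tabulate zero    f g = refl
sum-map-tabulate (suc n) f g = cong (f (g fzero) +_) (sum-map-tabulate n f (g ∘ fsuc))

sumFin≡sum : ∀ v (f : Fin v → ℕ) → sumFin v f ≡ ℕΣ.sum f
sumFin≡sum v f = sum-map-tabulate v f id

sumQ≡sum : ∀ k (f : Fin k → ℚ) → sumQ k f ≡ ℚΣ.sum f
sumQ≡sum zero    f = refl
sumQ≡sum (suc k) f = cong (f fzero ℚ.+_) (sumQ≡sum k (f ∘ fsuc))

ℕΣ-mono-≤ : ∀ {v} {f g : Fin v → ℕ} → (∀ i → f i ≤ g i) → ℕΣ.sum f ≤ ℕΣ.sum g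
ℕΣ-mono-≤ {zero}  f≤g = z≤n
ℕΣ-mono-≤ {suc v} f≤g = ℕ.+-mono-≤ (f≤g fzero) (ℕΣ-mono-≤ (f≤g ∘ fsuc))

ℚΣ-mono-≤ : ∀ {v} {f g : Fin v → ℚ} → (∀ i → f i ℚ.≤ g i) → ℚΣ.sum f ℚ.≤ ℚΣ.sum g
ℚΣ-mono-≤ {zero}  f≤g = ℚ.≤-refl
ℚΣ-mono-≤ {suc v} f≤g = ℚ.+-mono-≤ (f≤g fzero) (ℚΣ-mono-≤ (f≤g ∘ fsuc))

≤-sum : ∀ {v} (f : Fin v → ℕ) i → f i ≤ ℕΣ.sum f
≤-sum f fzero    = ℕ.m≤m+n _ _
≤-sum f (fsuc i) = ℕ.≤-trans (≤-sum (f ∘ fsuc) i) (ℕ.m≤n+m _ _)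

fromℕ : ℕ → ℚ
fromℕ a = ℤ.+ a ℚ./ 1

toℚᵘ-/ : ∀ a s → ℚ.toℚᵘ (ℤ.+ a ℚ./ suc s) ℚᵘ.≃ ℚᵘ.mkℚᵘ (ℤ.+ a) s
toℚᵘ-/ a s = ℚ.toℚᵘ-fromℚᵘ (ℚᵘ.mkℚᵘ (ℤ.+ a) s)

frac-≤-frac : ∀ a b s t → a * suc t ≤ b * suc s → ℤ.+ a ℚ./ suc s ℚ.≤ ℤ.+ b ℚ./ suc t
frac-≤-frac a b s t at≤bs = ℚ.toℚᵘ-cancel-≤
  (ℚᵘ.≤-respˡ-≃ (ℚᵘ.≃-sym (toℚᵘ-/ a s)) (ℚᵘ.≤-respʳ-≃ (ℚᵘ.≃-sym (toℚᵘ-/ b t))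
    (ℚᵘ.*≤* (subst₂ ℤ._≤_ (ℤ.pos-* a (suc t)) (ℤ.pos-* b (suc s)) (ℤ.+≤+ at≤bs)))))

frac-*-frac : ∀ a b s t →
  (ℤ.+ a ℚ./ suc s) ℚ.* (ℤ.+ b ℚ./ suc t) ≡ ℤ.+ (a * b) ℚ./ (suc s * suc t)
frac-*-frac a b s t = ℚ.toℚᵘ-injective (begin-equality
    ℚ.toℚᵘ (p ℚ.* q)                                  ≃⟨ ℚ.toℚᵘ-homo-* p q ⟩
    ℚ.toℚᵘ p ℚᵘ.* ℚ.toℚᵘ q                           ≃⟨ ℚᵘ.*-cong (toℚᵘ-/ a s) (toℚᵘ-/ b t) ⟩
    ℚᵘ.mkℚᵘ (ℤ.+ a ℤ.* ℤ.+ b) (t + s * suc t)         ≡⟨ cong (λ z → ℚᵘ.mkℚᵘ z _) (ℤ.pos-* a b) ⟨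
    ℚᵘ.mkℚᵘ (ℤ.+ (a * b)) (t + s * suc t)             ≃⟨ ℚᵘ.≃-sym (toℚᵘ-/ (a * b) (t + s * suc t)) ⟩
    ℚ.toℚᵘ (ℤ.+ (a * b) ℚ./ (suc s * suc t))          ∎)
  where
  open ℚᵘ.≤-Reasoning
  p = ℤ.+ a ℚ./ suc s
  q = ℤ.+ b ℚ./ suc t

frac-+-frac : ∀ a b s t →
  (ℤ.+ a ℚ./ suc s) ℚ.+ (ℤ.+ b ℚ./ suc t) ≡ ℤ.+ (a * suc t + b * suc s) ℚ./ (suc s * suc t)
frac-+-frac a b s t = ℚ.toℚᵘ-injective (begin-equality
    ℚ.toℚᵘ (p ℚ.+ q)                                  ≃⟨ ℚ.toℚᵘ-homo-+ p q ⟩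
    ℚ.toℚᵘ p ℚᵘ.+ ℚ.toℚᵘ q                           ≃⟨ ℚᵘ.+-cong (toℚᵘ-/ a s) (toℚᵘ-/ b t) ⟩
    ℚᵘ.mkℚᵘ (ℤ.+ a ℤ.* ℤ.+ suc t ℤ.+ ℤ.+ b ℤ.* ℤ.+ suc s) (t + s * suc t)
      ≡⟨ cong (λ z → ℚᵘ.mkℚᵘ z _) numerator ⟨
    ℚᵘ.mkℚᵘ (ℤ.+ (a * suc t + b * suc s)) (t + s * suc t)
      ≃⟨ ℚᵘ.≃-sym (toℚᵘ-/ (a * suc t + b * suc s) (t + s * suc t)) ⟩
    ℚ.toℚᵘ (ℤ.+ (a * suc t + b * suc s) ℚ./ (suc s * suc t)) ∎)
  where
  open ℚᵘ.≤-Reasoning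
  p = ℤ.+ a ℚ./ suc s
  q = ℤ.+ b ℚ./ suc t
  numerator : ℤ.+ (a * suc t + b * suc s) ≡ ℤ.+ a ℤ.* ℤ.+ suc t ℤ.+ ℤ.+ b ℤ.* ℤ.+ suc s
  numerator = trans (ℤ.pos-+ (a * suc t) (b * suc s))
                    (cong₂ ℤ._+_ (ℤ.pos-* a (suc t)) (ℤ.pos-* b (suc s)))

fromℕ-mono-≤ : ∀ {a b} → a ≤ b → fromℕ a ℚ.≤ fromℕ b
fromℕ-mono-≤ {a} {b} a≤b = frac-≤-frac a b 0 0 (ℕ.*-monoˡ-≤ 1 a≤b)

fromℕ-+ : ∀ a b → fromℕ (a + b) ≡ fromℕ a ℚ.+ fromℕ b
fromℕ-+ a b = ≡.sym (trans (frac-+-frac a b 0 0)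
  (cong (λ z → ℤ.+ z ℚ./ 1) (cong₂ _+_ (ℕ.*-identityʳ a) (ℕ.*-identityʳ b))))

fromℕ-* : ∀ a b → fromℕ (a * b) ≡ fromℕ a ℚ.* fromℕ b
fromℕ-* a b = ≡.sym (frac-*-frac a b 0 0)

fromℕ-sum : ∀ {k} (f : Fin k → ℕ) → fromℕ (ℕΣ.sum f) ≡ ℚΣ.sum (fromℕ ∘ f)
fromℕ-sum {zero}  f = refl
fromℕ-sum {suc k} f = trans (fromℕ-+ (f fzero) _) (cong (fromℕ (f fzero) ℚ.+_) (fromℕ-sum (f ∘ fsuc)))

ℚΣ-const : ∀ k x → ℚΣ.sum {k} (λ _ → x) ≡ fromℕ k ℚ.* x
ℚΣ-const zero    x = ≡.sym (ℚ.*-zeroˡ x)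
ℚΣ-const (suc k) x = begin
  x ℚ.+ ℚΣ.sum {k} (λ _ → x)     ≡⟨ cong₂ ℚ._+_ (≡.sym (ℚ.*-identityˡ x)) (ℚΣ-const k x) ⟩
  ℚ.1ℚ ℚ.* x ℚ.+ fromℕ k ℚ.* x   ≡⟨ ℚ.*-distribʳ-+ x ℚ.1ℚ (fromℕ k) ⟨
  (ℚ.1ℚ ℚ.+ fromℕ k) ℚ.* x       ≡⟨ cong (ℚ._* x) (fromℕ-+ 1 k) ⟨
  fromℕ (suc k) ℚ.* x            ∎
  where open ≡-Reasoning

0≤x*x : ∀ x → ℚ.0ℚ ℚ.≤ x ℚ.* x
0≤x*x x with ℚ.≤-total ℚ.0ℚ x
... | inj₁ 0≤x = subst (ℚ._≤ x ℚ.* x) (ℚ.*-zeroʳ x) (ℚ.*-monoˡ-≤-nonNeg x {{ℚ.nonNegative 0≤x}} 0≤x)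
... | inj₂ x≤0 = subst (ℚ._≤ x ℚ.* x) (ℚ.*-zeroʳ x) (ℚ.*-monoˡ-≤-nonPos x {{ℚ.nonPositive x≤0}} x≤0)

x*y+x*y≤x*x+y*y : ∀ x y → x ℚ.* y ℚ.+ x ℚ.* y ℚ.≤ x ℚ.* x ℚ.+ y ℚ.* y
x*y+x*y≤x*x+y*y x y = begin
  x ℚ.* y ℚ.+ x ℚ.* y                                   ≡⟨ ℚ.+-identityʳ _ ⟨
  x ℚ.* y ℚ.+ x ℚ.* y ℚ.+ ℚ.0ℚ                          ≤⟨ ℚ.+-monoʳ-≤ (x ℚ.* y ℚ.+ x ℚ.* y) (0≤x*x (x ℚ.- y)) ⟩
  x ℚ.* y ℚ.+ x ℚ.* y ℚ.+ (x ℚ.- y) ℚ.* (x ℚ.- y)     ≡⟨ square-expansion x y ⟩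
  x ℚ.* x ℚ.+ y ℚ.* y                                   ∎
  where
  open ℚ.≤-Reasoning
  open +-*-Solver
  square-expansion : ∀ x y →
    x ℚ.* y ℚ.+ x ℚ.* y ℚ.+ (x ℚ.- y) ℚ.* (x ℚ.- y) ≡ x ℚ.* x ℚ.+ y ℚ.* y
  square-expansion = solve 2 (λ x y → x :* y :+ x :* y :+ (x :- y) :* (x :- y) := x :* x :+ y :* y) refl

x+x≤y+y⇒x≤y : ∀ {x y} → x ℚ.+ x ℚ.≤ y ℚ.+ y → x ℚ.≤ y
x+x≤y+y⇒x≤y x+x≤y+y = ℚ.≮⇒≥ (λ y<x → ℚ.<-irrefl refl (ℚ.≤-<-trans x+x≤y+y (ℚ.+-mono-< y<x y<x)))

ℚΣΣ-distrib-+ : ∀ {m n} (f g : Fin m → Fin n → ℚ) →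
  ℚΣ.sum (λ i → ℚΣ.sum (λ j → f i j ℚ.+ g i j))
    ≡ ℚΣ.sum (λ i → ℚΣ.sum (f i)) ℚ.+ ℚΣ.sum (λ i → ℚΣ.sum (g i))
ℚΣΣ-distrib-+ f g = trans (ℚΣ.sum-cong-≗ (λ i → ℚΣ.∑-distrib-+ (f i) (g i)))
                          (ℚΣ.∑-distrib-+ (λ i → ℚΣ.sum (f i)) (λ i → ℚΣ.sum (g i)))

-- Summing 2 d i d j ≤ d i ² + d j ² over all pairs (i , j).
cauchy-schwarz : ∀ {k} (d : Fin k → ℚ) →
  ℚΣ.sum d ℚ.* ℚΣ.sum d ℚ.≤ fromℕ k ℚ.* ℚΣ.sum (λ i → d i ℚ.* d i)
cauchy-schwarz {k} d = x+x≤y+y⇒x≤y (begin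
  S ℚ.* S ℚ.+ S ℚ.* S                       ≡⟨ cong₂ ℚ._+_ S*S≡ΣΣ S*S≡ΣΣ ⟩
  ΣΣ (λ i j → d i ℚ.* d j) ℚ.+ ΣΣ (λ i j → d i ℚ.* d j)
    ≡⟨ ℚΣΣ-distrib-+ (λ i j → d i ℚ.* d j) (λ i j → d i ℚ.* d j) ⟨
  ΣΣ (λ i j → d i ℚ.* d j ℚ.+ d i ℚ.* d j)
    ≤⟨ ℚΣ-mono-≤ (λ i → ℚΣ-mono-≤ (λ j → x*y+x*y≤x*x+y*y (d i) (d j))) ⟩
  ΣΣ (λ i j → d i ℚ.* d i ℚ.+ d j ℚ.* d j)
    ≡⟨ ℚΣΣ-distrib-+ (λ i _ → d i ℚ.* d i) (λ _ j → d j ℚ.* d j) ⟩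
  ΣΣ (λ i _ → d i ℚ.* d i) ℚ.+ ΣΣ (λ _ j → d j ℚ.* d j)
    ≡⟨ cong₂ ℚ._+_ (trans (ℚΣ.sum-cong-≗ (λ i → ℚΣ-const k (d i ℚ.* d i)))
                          (≡.sym (ℚΣ.*-distribˡ-sum (fromℕ k) (λ i → d i ℚ.* d i))))
                   (ℚΣ-const k Q) ⟩
  fromℕ k ℚ.* Q ℚ.+ fromℕ k ℚ.* Q           ∎)
  where
  open ℚ.≤-Reasoning
  S = ℚΣ.sum d
  Q = ℚΣ.sum (λ i → d i ℚ.* d i)
  ΣΣ : (Fin k → Fin k → ℚ) → ℚ
  ΣΣ f = ℚΣ.sum (λ i → ℚΣ.sum (f i))
  S*S≡ΣΣ : S ℚ.* S ≡ ΣΣ (λ i j → d i ℚ.* d j)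
  S*S≡ΣΣ = trans (ℚΣ.*-distribʳ-sum S d) (ℚΣ.sum-cong-≗ (λ i → ℚΣ.*-distribˡ-sum (d i) d))

0<fromℕ : ∀ {a} → 1 ≤ a → ℚ.0ℚ ℚ.< fromℕ a
0<fromℕ {suc a} _ = ℚ.positive⁻¹ _ {{ℚ.normalize-pos (suc a) 1}}

x*x+c*x≤y⇒x*x<y : ∀ {x c y} → ℚ.0ℚ ℚ.≤ x → ℚ.0ℚ ℚ.< c → ℚ.0ℚ ℚ.< y →
                  x ℚ.* x ℚ.+ c ℚ.* x ℚ.≤ y → x ℚ.* x ℚ.< y
x*x+c*x≤y⇒x*x<y {x} {c} {y} 0≤x 0<c 0<y x*x+c*x≤y with ℚ.<-cmp ℚ.0ℚ x
... | tri< 0<x _ _ = ℚ.<-≤-trans (begin-strict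
  x ℚ.* x                  ≡⟨ ℚ.+-identityʳ (x ℚ.* x) ⟨
  x ℚ.* x ℚ.+ ℚ.0ℚ         <⟨ ℚ.+-monoʳ-< (x ℚ.* x) 0<c*x ⟩
  x ℚ.* x ℚ.+ c ℚ.* x      ∎) x*x+c*x≤y
  where
  open ℚ.≤-Reasoning
  0<c*x = subst (ℚ._< c ℚ.* x) (ℚ.*-zeroʳ c) (ℚ.*-monoʳ-<-pos c {{ℚ.positive 0<c}} 0<x)
... | tri≈ _ refl _ = 0<y
... | tri> _ _ x<0  = ⊥-elim (ℚ.<-irrefl refl (ℚ.<-≤-trans x<0 0≤x))

-- Pairs and densities

C₂ : ℕ → ℕ
C₂ zero    = 0
C₂ (suc n) = n + C₂ n

C≡C₂ : ∀ n → n C 2 ≡ C₂ n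
C≡C₂ zero    = refl
C≡C₂ (suc n) = trans (≡.sym (ℕ.nCk+nC[k+1]≡[n+1]C[k+1] n 1)) (cong₂ _+_ (ℕ.nC1≡n n) (C≡C₂ n))

C₂-mono-≤ : ∀ {a b} → a ≤ b → C₂ a ≤ C₂ b
C₂-mono-≤ z≤n       = z≤n
C₂-mono-≤ (s≤s a≤b) = ℕ.+-mono-≤ a≤b (C₂-mono-≤ a≤b)

C₂+C₂+n≡n*n : ∀ n → C₂ n + C₂ n + n ≡ n * n
C₂+C₂+n≡n*n zero    = refl
C₂+C₂+n≡n*n (suc n) = begin
  (n + C₂ n) + (n + C₂ n) + suc n   ≡⟨ regroup n (C₂ n) ⟩
  suc (n + n + (C₂ n + C₂ n + n))   ≡⟨ cong (λ z → suc (n + n + z)) (C₂+C₂+n≡n*n n) ⟩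
  suc (n + n + n * n)               ≡⟨ expand n ⟨
  suc n * suc n                     ∎
  where
  open ≡-Reasoning
  regroup : ∀ n c → (n + c) + (n + c) + suc n ≡ suc (n + n + (c + c + n))
  regroup = solve-∀
  expand : ∀ n → suc n * suc n ≡ suc (n + n + n * n)
  expand = solve-∀

2a+n≤n*n : ∀ {a} n → a ≤ C₂ n → 2 * a + n ≤ n * n
2a+n≤n*n {a} n a≤C₂n = begin
  2 * a + n         ≡⟨ cong (λ z → a + z + n) (ℕ.+-identityʳ a) ⟩
  a + a + n         ≤⟨ ℕ.+-monoˡ-≤ n (ℕ.+-mono-≤ a≤C₂n a≤C₂n) ⟩
  C₂ n + C₂ n + n   ≡⟨ C₂+C₂+n≡n*n n ⟩
  n * n             ∎
  where open ℕ.≤-Reasoning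

2kC₂n<kn² : ∀ {k n} → 1 ≤ k → 1 ≤ n → 2 * k * C₂ n < k * (n * n)
2kC₂n<kn² {suc k} {n} _ 1≤n = subst (_< suc k * (n * n)) (reorder (suc k) (C₂ n))
  (ℕ.*-monoʳ-< (suc k) (ℕ.<-≤-trans (ℕ.m<m+n (2 * C₂ n) 1≤n)
    (ℕ.≤-reflexive (trans (cong (λ c → c + n) (double (C₂ n))) (C₂+C₂+n≡n*n n)))))
  where
  reorder : ∀ k c → k * (2 * c) ≡ 2 * k * c
  reorder = solve-∀
  double : ∀ c → 2 * c ≡ c + c
  double = solve-∀

dens-nonneg : ∀ a s → ℚ.0ℚ ℚ.≤ dens a s
dens-nonneg a zero    = ℚ.≤-refl
dens-nonneg a (suc s) = frac-≤-frac 0 (2 * a) 0 s z≤n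

dens-cross-≤ : ∀ a b s t → a * suc t ≤ b * suc s → dens a (suc s) ℚ.≤ dens b (suc t)
dens-cross-≤ a b s t at≤bs = frac-≤-frac (2 * a) (2 * b) s t
  (subst₂ _≤_ (≡.sym (ℕ.*-assoc 2 a (suc t))) (≡.sym (ℕ.*-assoc 2 b (suc s))) (ℕ.*-monoʳ-≤ 2 at≤bs))

dens-mono-≤ : ∀ {a b} s → a ≤ b → dens a s ℚ.≤ dens b s
dens-mono-≤         zero    a≤b = ℚ.≤-refl
dens-mono-≤ {a} {b} (suc s) a≤b = dens-cross-≤ a b s s (ℕ.*-monoˡ-≤ (suc s) a≤b)

dens-antitone : ∀ {a s t} → 1 ≤ t → t ≤ s → dens a s ℚ.≤ dens a t
dens-antitone {a} {suc s} {suc t} _ t≤s = dens-cross-≤ a a s t (ℕ.*-monoʳ-≤ a t≤s)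

dens*dens+dens≤ : ∀ {a} s → a ≤ C₂ s → dens a s ℚ.* dens a s ℚ.+ dens a s ℚ.≤ fromℕ (2 * a)
dens*dens+dens≤ {a} zero _ = fromℕ-mono-≤ {0} {2 * a} z≤n
dens*dens+dens≤ {a} (suc s) a≤C₂S = begin
  m ℚ.* m ℚ.+ m
    ≡⟨ cong (ℚ._+ m) (frac-*-frac A A s s) ⟩
  ℤ.+ (A * A) ℚ./ (S * S) ℚ.+ m
    ≡⟨ frac-+-frac (A * A) A (s + s * S) s ⟩
  ℤ.+ (A * A * S + A * (S * S)) ℚ./ (S * S * S)
    ≤⟨ frac-≤-frac (A * A * S + A * (S * S)) A (s + (s + s * S) * S) 0 numerator-≤ ⟩
  fromℕ A ∎
  where
  open ℚ.≤-Reasoning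
  A = 2 * a
  S = suc s
  m = dens a S
  numerator-≤ : (A * A * S + A * (S * S)) * 1 ≤ A * (S * S * S)
  numerator-≤ = subst₂ _≤_ (≡.sym (factor A S)) (unfactor A S)
    (ℕ.*-monoʳ-≤ (A * S) (2a+n≤n*n S a≤C₂S))
    where
    factor : ∀ A S → (A * A * S + A * (S * S)) * 1 ≡ A * S * (A + S)
    factor = solve-∀
    unfactor : ∀ A S → A * S * (S * S) ≡ A * (S * S * S)
    unfactor = solve-∀

-- Graphs and edge counts

<ᵇ≡true⇒< : ∀ {m n} → (m <ᵇ n) ≡ true → m < n
<ᵇ≡true⇒< {m} {n} m<ᵇn = ℕ.<ᵇ⇒< m n (Equivalence.from Bool.T-≡ m<ᵇn)

<⇒<ᵇ≡true : ∀ {m n} → m < n → (m <ᵇ n) ≡ true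
<⇒<ᵇ≡true m<n = Equivalence.to Bool.T-≡ (ℕ.<⇒<ᵇ m<n)

≥⇒<ᵇ≡false : ∀ {m n} → n ≤ m → (m <ᵇ n) ≡ false
≥⇒<ᵇ≡false n≤m = Bool.¬-not (λ m<ᵇn → ℕ.<⇒≱ (<ᵇ≡true⇒< m<ᵇn) n≤m)

𝟙 : Bool → ℕ
𝟙 b = if b then 1 else 0

𝟙-∧-mono : ∀ {b b′} c → (b ≡ true → b′ ≡ true) → 𝟙 (b ∧ c) ≤ 𝟙 (b′ ∧ c)
𝟙-∧-mono {false} c _    = z≤n
𝟙-∧-mono {true}  c b⇒b′ rewrite b⇒b′ refl = ℕ.≤-refl

ℕΣ-ones : ∀ v → ℕΣ.sum {v} (λ _ → 1) ≡ v
ℕΣ-ones zero    = refl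
ℕΣ-ones (suc v) = cong suc (ℕΣ-ones v)

edgeCount : ∀ {v} → (Fin v → Fin v → Bool) → ℕ
edgeCount P = ℕΣ.sum (λ i → ℕΣ.sum (λ j → 𝟙 (P i j ∧ (toℕ i <ᵇ toℕ j))))

e≡edgeCount : ∀ {v} (G : Graph v) → e G ≡ edgeCount (adj G)
e≡edgeCount {v} G = trans (sumFin≡sum v _) (ℕΣ.sum-cong-≗ {v} (λ i → sumFin≡sum v _))

edgeCount-suc : ∀ {v} (P : Fin (suc v) → Fin (suc v) → Bool) →
  edgeCount P ≡ ℕΣ.sum (λ j → 𝟙 (P fzero (fsuc j))) + edgeCount (λ i j → P (fsuc i) (fsuc j))
edgeCount-suc {v} P = cong₂ _+_
  (cong₂ _+_ (cong 𝟙 (Bool.∧-zeroʳ (P fzero fzero)))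
             (ℕΣ.sum-cong-≗ {v} (λ j → cong 𝟙 (Bool.∧-identityʳ (P fzero (fsuc j))))))
  (ℕΣ.sum-cong-≗ {v} (λ i → cong (_+ row i) (cong 𝟙 (Bool.∧-zeroʳ (P (fsuc i) fzero)))))
  where
  row : Fin v → ℕ
  row i = ℕΣ.sum (λ j → 𝟙 (P (fsuc i) (fsuc j) ∧ (toℕ i <ᵇ toℕ j)))

edgeCount-mono : ∀ {v} {P Q : Fin v → Fin v → Bool} →
  (∀ i j → P i j ≡ true → Q i j ≡ true) → edgeCount P ≤ edgeCount Q
edgeCount-mono P⇒Q = ℕΣ-mono-≤ (λ i → ℕΣ-mono-≤ (λ j → 𝟙-∧-mono _ (P⇒Q i j)))

edgeCount-complete : ∀ v → edgeCount {v} (λ _ _ → true) ≡ C₂ v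
edgeCount-complete zero    = refl
edgeCount-complete (suc v) =
  trans (edgeCount-suc {v} (λ _ _ → true)) (cong₂ _+_ (ℕΣ-ones v) (edgeCount-complete v))

ℕΣ-lookup : ∀ {v} (S : Subset v) → ℕΣ.sum (λ j → 𝟙 (lookup S j)) ≡ ∣ S ∣
ℕΣ-lookup []          = refl
ℕΣ-lookup (true ∷ S)  = cong suc (ℕΣ-lookup S)
ℕΣ-lookup (false ∷ S) = ℕΣ-lookup S

bothIn : ∀ {v} → Subset v → Fin v → Fin v → Bool
bothIn S i j = lookup S i ∧ lookup S j

edgeCount-bothIn : ∀ {v} (S : Subset v) → edgeCount (bothIn S) ≡ C₂ ∣ S ∣
edgeCount-bothIn []          = refl
edgeCount-bothIn (true ∷ S)  =
  trans (edgeCount-suc (bothIn (true ∷ S))) (cong₂ _+_ (ℕΣ-lookup S) (edgeCount-bothIn S))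
edgeCount-bothIn {suc v} (false ∷ S) =
  trans (edgeCount-suc (bothIn (false ∷ S))) (cong₂ _+_ (ℕΣ.sum-replicate-zero v) (edgeCount-bothIn S))

_⊆ᴱ_ : ∀ {v} → Graph v → Graph v → Set
H ⊆ᴱ G = ∀ i j → adj H i j ≡ true → adj G i j ≡ true

e-mono : ∀ {v} (H G : Graph v) → H ⊆ᴱ G → e H ≤ e G
e-mono H G H⊆G = subst₂ _≤_ (≡.sym (e≡edgeCount H)) (≡.sym (e≡edgeCount G)) (edgeCount-mono H⊆G)

e-cong : ∀ {v} (G H : Graph v) → (∀ i j → adj G i j ≡ adj H i j) → e G ≡ e H
e-cong {v} G H G≗H = trans (e≡edgeCount G) (trans
  (ℕΣ.sum-cong-≗ {v} (λ i → ℕΣ.sum-cong-≗ {v} (λ j → cong (λ b → 𝟙 (b ∧ (toℕ i <ᵇ toℕ j))) (G≗H i j))))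
  (≡.sym (e≡edgeCount H)))

isSubgraph⇒e≤e : ∀ {v} (G H : Graph v) {S} → IsSubgraph G S H → e H ≤ e G
isSubgraph⇒e≤e G H H⊆G = e-mono H G (λ i j ij∈H → proj₁ (H⊆G i j ij∈H))

isSubgraph⇒e≤C₂ : ∀ {v} (G H : Graph v) {S} → IsSubgraph G S H → e H ≤ C₂ ∣ S ∣
isSubgraph⇒e≤C₂ G H {S} H⊆G = subst₂ _≤_ (≡.sym (e≡edgeCount H)) (edgeCount-bothIn S)
  (edgeCount-mono λ i j ij∈H → let _ , i∈S , j∈S = H⊆G i j ij∈H in
    cong₂ _∧_ (Vec.[]=⇒lookup i∈S) (Vec.[]=⇒lookup j∈S))

symmetrise : ∀ {v} → (Fin v → Fin v → Bool) → Graph v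
symmetrise {v} f = record { adj = adj′ ; sym = adj′-sym ; irrefl = adj′-irrefl }
  where
  adj′ : Fin v → Fin v → Bool
  adj′ i j = if toℕ i <ᵇ toℕ j then f i j else if toℕ j <ᵇ toℕ i then f j i else false
  adj′-sym : ∀ i j → adj′ i j ≡ adj′ j i
  adj′-sym i j with toℕ i <ᵇ toℕ j | ℕ.<ᵇ-reflects-< (toℕ i) (toℕ j)
                  | toℕ j <ᵇ toℕ i | ℕ.<ᵇ-reflects-< (toℕ j) (toℕ i)
  ... | true  | ofʸ i<j | true  | ofʸ j<i = ⊥-elim (ℕ.<-asym i<j j<i)
  ... | true  | _       | false | _       = refl
  ... | false | _       | true  | _       = refl
  ... | false | _       | false | _       = refl
  adj′-irrefl : ∀ i → adj′ i i ≡ false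
  adj′-irrefl i rewrite ≥⇒<ᵇ≡false (ℕ.≤-refl {toℕ i}) = refl

adj-symmetrise-< : ∀ {v} (f : Fin v → Fin v → Bool) {i j} → toℕ i < toℕ j →
                   adj (symmetrise f) i j ≡ f i j
adj-symmetrise-< f i<j rewrite <⇒<ᵇ≡true i<j = refl

adj-symmetrise-> : ∀ {v} (f : Fin v → Fin v → Bool) {i j} → toℕ j < toℕ i →
                   adj (symmetrise f) i j ≡ f j i
adj-symmetrise-> f j<i rewrite ≥⇒<ᵇ≡false (ℕ.<⇒≤ j<i) | <⇒<ᵇ≡true j<i = refl

e-symmetrise : ∀ {v} (f : Fin v → Fin v → Bool) → e (symmetrise f) ≡ edgeCount f
e-symmetrise {v} f = trans (e≡edgeCount (symmetrise f))
  (ℕΣ.sum-cong-≗ {v} (λ i → ℕΣ.sum-cong-≗ {v} (λ j → same-summand i j)))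
  where
  same-summand : ∀ i j → 𝟙 (adj (symmetrise f) i j ∧ (toℕ i <ᵇ toℕ j)) ≡ 𝟙 (f i j ∧ (toℕ i <ᵇ toℕ j))
  same-summand i j with toℕ i <ᵇ toℕ j
  ... | true  = refl
  ... | false = cong 𝟙 (trans (Bool.∧-zeroʳ _) (≡.sym (Bool.∧-zeroʳ (f i j))))

adj⇒≢ : ∀ {v} (G : Graph v) {i j} → adj G i j ≡ true → i ≢ j
adj⇒≢ G {i} ij∈G refl with trans (≡.sym ij∈G) (irrefl G i)
... | ()

induced : ∀ {v} → Graph v → Subset v → Graph v
induced G S = record
  { adj    = λ i j → adj G i j ∧ bothIn S i j
  ; sym    = λ i j → cong₂ _∧_ (sym G i j) (Bool.∧-comm (lookup S i) (lookup S j))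
  ; irrefl = λ i → cong (_∧ bothIn S i i) (irrefl G i)
  }

induced-isSubgraph : ∀ {v} (G : Graph v) S → IsSubgraph G S (induced G S)
induced-isSubgraph G S i j ij∈G[S] =
  Bool.∧-conicalˡ _ _ ij∈G[S] ,
  Vec.lookup⇒[]= i S (Bool.∧-conicalˡ _ _ ij∈S) ,
  Vec.lookup⇒[]= j S (Bool.∧-conicalʳ _ _ ij∈S)
  where ij∈S = Bool.∧-conicalʳ (adj G i j) _ ij∈G[S]

isSubgraph⇒⊆ᴱinduced : ∀ {v} (G H : Graph v) {S} → IsSubgraph G S H → H ⊆ᴱ induced G S
isSubgraph⇒⊆ᴱinduced G H H⊆G i j ij∈H with H⊆G i j ij∈H
... | ij∈G , i∈S , j∈S rewrite ij∈G | Vec.[]=⇒lookup i∈S | Vec.[]=⇒lookup j∈S = refl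

-- Maximum average degree

Enumerates : {A : Set} → List A → Set
Enumerates xs = ∀ x → x ∈ xs

vectors : {A : Set} → List A → (m : ℕ) → List (Vec A m)
vectors xs zero    = List.[ [] ]
vectors xs (suc m) = List.cartesianProductWith _∷_ xs (vectors xs m)

vectors-enumerates : ∀ {A : Set} {xs : List A} {m} → Enumerates xs → Enumerates (vectors xs m)
vectors-enumerates xs-all []      = here refl
vectors-enumerates xs-all (x ∷ v) = ∈-cartesianProductWith⁺ _∷_ (xs-all x) (vectors-enumerates xs-all v)

bools-enumerate : Enumerates (true List.∷ List.[ false ])
bools-enumerate true  = here refl
bools-enumerate false = there (here refl)

-- Abstract so that the type checker never unfolds the search.
abstract
  maximiser : ∀ {A : Set} {P : A → Set} → Decidable P → (f : A → ℚ) → {xs : List A} → Enumerates xs →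
              ∀ x₀ → P x₀ → Σ A λ a → P a × (∀ x → P x → f x ℚ.≤ f a)
  maximiser P? f {xs} xs-all x₀ Px₀ =
    argmax f x₀ (filter P? xs) , argmax-all f Px₀ (all-filter P? xs) ,
    λ x Px → All.lookup (f[xs]≤f[argmax] x₀ (filter P? xs)) (∈-filter⁺ P? (xs-all x) Px)
    where open Data.List.Extrema (DecTotalOrder.totalOrder ℚ.≤-decTotalOrder)

isMad-nonneg : ∀ {v} (G : Graph v) {m} → IsMad G m → ℚ.0ℚ ℚ.≤ m
isMad-nonneg G (_ , inj₁ (S , H , _ , _ , refl)) = dens-nonneg (e H) ∣ S ∣
isMad-nonneg G (_ , inj₂ (_ , refl))             = ℚ.≤-refl

isMad-≤ : ∀ {v} (G : Graph v) {m x} →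
  (∀ S H → IsSubgraph G S H → 1 ≤ ∣ S ∣ → dens (e H) ∣ S ∣ ℚ.≤ x) → ℚ.0ℚ ℚ.≤ x →
  IsMad G m → m ℚ.≤ x
isMad-≤ G bound _   (_ , inj₁ (S , H , H⊆G , 1≤∣S∣ , refl)) = bound S H H⊆G 1≤∣S∣
isMad-≤ G _     0≤x (_ , inj₂ (_ , refl))                  = 0≤x

isMad-mono : ∀ {v} (G G′ : Graph v) {m m′} → G ⊆ᴱ G′ → IsMad G m → IsMad G′ m′ → m ℚ.≤ m′
isMad-mono G G′ {m′ = m′} G⊆G′ isMad isMad′ = isMad-≤ G bound (isMad-nonneg G′ isMad′) isMad
  where
  bound : ∀ S H → IsSubgraph G S H → 1 ≤ ∣ S ∣ → dens (e H) ∣ S ∣ ℚ.≤ m′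
  bound S H H⊆G = proj₁ isMad′ S H λ i j ij∈H →
    let ij∈G , i∈S , j∈S = H⊆G i j ij∈H in G⊆G′ i j ij∈G , i∈S , j∈S

-- m (m + 1) ≤ m s = 2 e(H) ≤ 2 e(G) for a densest subgraph H on s vertices, as m ≤ s - 1.
isMad-sq : ∀ {v} (G : Graph v) {m} → IsMad G m → m ℚ.* m ℚ.+ m ℚ.≤ fromℕ (2 * e G)
isMad-sq G (_ , inj₁ (S , H , H⊆G , _ , refl)) =
  ℚ.≤-trans (dens*dens+dens≤ ∣ S ∣ (isSubgraph⇒e≤C₂ G H H⊆G))
            (fromℕ-mono-≤ (ℕ.*-monoʳ-≤ 2 (isSubgraph⇒e≤e G H H⊆G)))
isMad-sq G (_ , inj₂ (_ , refl)) = fromℕ-mono-≤ {0} {2 * e G} z≤n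

inducedDensity : ∀ {v} → Graph v → Subset v → ℚ
inducedDensity G S = dens (e (induced G S)) ∣ S ∣

densestSubset : ∀ {v} (G : Graph (suc v)) → Σ (Subset (suc v)) λ S →
  1 ≤ ∣ S ∣ × (∀ T → 1 ≤ ∣ T ∣ → inducedDensity G T ℚ.≤ inducedDensity G S)
densestSubset {v} G = maximiser (λ S → 1 ℕ.≤? ∣ S ∣) (inducedDensity G)
  (vectors-enumerates bools-enumerate) ⊤ (subst (1 ≤_) (≡.sym (∣⊤∣≡n (suc v))) (s≤s z≤n))

mad : ∀ {v} → Graph (suc v) → ℚ
mad G = inducedDensity G (proj₁ (densestSubset G))

mad-isMad : ∀ {v} (G : Graph (suc v)) → IsMad G (mad G)
mad-isMad G =
  bound , inj₁ (S , induced G S , induced-isSubgraph G S , proj₁ (proj₂ (densestSubset G)) , refl)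
  where
  S = proj₁ (densestSubset G)
  bound : ∀ T H → IsSubgraph G T H → 1 ≤ ∣ T ∣ → dens (e H) ∣ T ∣ ℚ.≤ mad G
  bound T H H⊆G 1≤∣T∣ = ℚ.≤-trans
    (dens-mono-≤ ∣ T ∣ (e-mono H (induced G T) (isSubgraph⇒⊆ᴱinduced G H H⊆G)))
    (proj₂ (proj₂ (densestSubset G)) T 1≤∣T∣)

-- Colex graphs

⊓-∸-+-⊓ : ∀ V c E → V ⊓ (E ∸ c) + E ⊓ c ≡ E ⊓ (V + c)
⊓-∸-+-⊓ V c E with ℕ.≤-total E c
... | inj₁ E≤c = begin
  V ⊓ (E ∸ c) + E ⊓ c      ≡⟨ cong₂ _+_ (trans (cong (V ⊓_) (ℕ.m≤n⇒m∸n≡0 E≤c)) (ℕ.⊓-zeroʳ V))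
                                        (ℕ.m≤n⇒m⊓n≡m E≤c) ⟩
  E                        ≡⟨ ℕ.m≤n⇒m⊓n≡m (ℕ.≤-trans E≤c (ℕ.m≤n+m c V)) ⟨
  E ⊓ (V + c)              ∎
  where open ≡-Reasoning
... | inj₂ c≤E = begin
  V ⊓ (E ∸ c) + E ⊓ c      ≡⟨ cong (V ⊓ (E ∸ c) +_) (ℕ.m≥n⇒m⊓n≡n c≤E) ⟩
  V ⊓ (E ∸ c) + c          ≡⟨ ℕ.+-distribʳ-⊓ c V (E ∸ c) ⟩
  (V + c) ⊓ (E ∸ c + c)    ≡⟨ cong ((V + c) ⊓_) (ℕ.m∸n+n≡m c≤E) ⟩
  (V + c) ⊓ E              ≡⟨ ℕ.⊓-comm (V + c) E ⟩
  E ⊓ (V + c)              ∎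
  where open ≡-Reasoning

𝟙[c+V<E]+V⊓[E∸c] : ∀ c V E → 𝟙 (c + V <ᵇ E) + V ⊓ (E ∸ c) ≡ suc V ⊓ (E ∸ c)
𝟙[c+V<E]+V⊓[E∸c] c V E with c + V <ᵇ E | ℕ.<ᵇ-reflects-< (c + V) E
... | true  | ofʸ c+V<E = trans (cong suc (ℕ.m≤n⇒m⊓n≡m (ℕ.<⇒≤ V<E∸c))) (≡.sym (ℕ.m≤n⇒m⊓n≡m V<E∸c))
  where V<E∸c = ℕ.m+n≤o⇒m≤o∸n (suc V) (subst (_≤ E) (cong suc (ℕ.+-comm c V)) c+V<E)
... | false | ofⁿ c+V≮E = trans (ℕ.m≥n⇒m⊓n≡n E∸c≤V) (≡.sym (ℕ.m≥n⇒m⊓n≡n (ℕ.m≤n⇒m≤1+n E∸c≤V)))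
  where E∸c≤V = ℕ.m≤n+o⇒m∸n≤o E c (ℕ.≮⇒≥ c+V≮E)

-- Vertex i of the colex graph on V vertices carries the label V ∸ suc (toℕ i); the pair
-- with labels x > y is the (C₂ x + y)-th pair in colexicographic order, and colex V E
-- keeps the first E pairs.  Labels rather than indices make edgeCount-suc peel off the
-- vertex with the largest label.
label : ∀ {V} → Fin V → ℕ
label {V} i = V ∸ suc (toℕ i)

colexPairs : (V E : ℕ) → Fin V → Fin V → Bool
colexPairs V E i j = C₂ (label i) + label j <ᵇ E

colex : (V E : ℕ) → Graph V
colex V E = symmetrise (colexPairs V E)

colexRow : ∀ V c E → ℕΣ.sum {V} (λ j → 𝟙 (c + label j <ᵇ E)) ≡ V ⊓ (E ∸ c)
colexRow zero    c E = refl
colexRow (suc V) c E = trans (cong (𝟙 (c + V <ᵇ E) +_) (colexRow V c E)) (𝟙[c+V<E]+V⊓[E∸c] c V E)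

edgeCount-colex : ∀ V E → edgeCount (colexPairs V E) ≡ E ⊓ C₂ V
edgeCount-colex zero    E = ≡.sym (ℕ.⊓-zeroʳ E)
edgeCount-colex (suc V) E = begin
  edgeCount (colexPairs (suc V) E)
    ≡⟨ edgeCount-suc (colexPairs (suc V) E) ⟩
  ℕΣ.sum {V} (λ j → 𝟙 (C₂ V + label j <ᵇ E)) + edgeCount (colexPairs V E)
    ≡⟨ cong₂ _+_ (colexRow V (C₂ V) E) (edgeCount-colex V E) ⟩
  V ⊓ (E ∸ C₂ V) + E ⊓ C₂ V
    ≡⟨ ⊓-∸-+-⊓ V (C₂ V) E ⟩
  E ⊓ C₂ (suc V) ∎
  where open ≡-Reasoning

e-colex : ∀ V E → e (colex V E) ≡ E ⊓ C₂ V
e-colex V E = trans (e-symmetrise (colexPairs V E)) (edgeCount-colex V E)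

labelBelow : (V s : ℕ) → Subset V
labelBelow V s = Vec.tabulate (λ i → label i <ᵇ s)

∣labelBelow∣ : ∀ V s → ∣ labelBelow V s ∣ ≡ V ⊓ s
∣labelBelow∣ zero    s = refl
∣labelBelow∣ (suc V) s with V <ᵇ s | ℕ.<ᵇ-reflects-< V s
... | true  | ofʸ V<s = trans (cong suc (trans (∣labelBelow∣ V s) (ℕ.m≤n⇒m⊓n≡m (ℕ.<⇒≤ V<s))))
                              (≡.sym (ℕ.m≤n⇒m⊓n≡m V<s))
... | false | ofⁿ V≮s = trans (trans (∣labelBelow∣ V s) (ℕ.m≥n⇒m⊓n≡n s≤V))
                              (≡.sym (ℕ.m≥n⇒m⊓n≡n (ℕ.m≤n⇒m≤1+n s≤V)))
  where s≤V = ℕ.≮⇒≥ V≮s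

C₂x+y<C₂s : ∀ {x y s} → y ≤ x → C₂ x + y < C₂ s → x < s × y < s
C₂x+y<C₂s {x} {y} {s} y≤x rank<C₂s = x<s , ℕ.≤-<-trans y≤x x<s
  where
  x<s = ℕ.≰⇒> (λ s≤x → ℕ.<⇒≱ (ℕ.≤-<-trans (ℕ.m≤m+n (C₂ x) y) rank<C₂s) (C₂-mono-≤ s≤x))

colex-restrict-pair : ∀ V E s (i j : Fin V) → toℕ i < toℕ j → colexPairs V (E ⊓ C₂ s) i j ≡ true →
  (colexPairs V E i j ≡ true) × (i ∈ˢ labelBelow V s) × (j ∈ˢ labelBelow V s)
colex-restrict-pair V E s i j i<j ij∈colex =
  <⇒<ᵇ≡true (ℕ.<-≤-trans rank< (ℕ.m⊓n≤m E (C₂ s))) , below i (proj₁ labels<s) , below j (proj₂ labels<s)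
  where
  rank< = <ᵇ≡true⇒< ij∈colex
  labels<s = C₂x+y<C₂s (ℕ.∸-monoʳ-≤ V (ℕ.m≤n⇒m≤1+n i<j)) (ℕ.<-≤-trans rank< (ℕ.m⊓n≤n E (C₂ s)))
  below : ∀ k → label k < s → k ∈ˢ labelBelow V s
  below k k<s = Vec.lookup⇒[]= k _ (trans (Vec.lookup∘tabulate _ k) (<⇒<ᵇ≡true k<s))

-- The first C₂ s pairs in colex order are the pairs of vertices with labels below s.
colex-restrict : ∀ V E s → IsSubgraph (colex V E) (labelBelow V s) (colex V (E ⊓ C₂ s))
colex-restrict V E s i j ij∈H with ℕ.<-cmp (toℕ i) (toℕ j)
... | tri< i<j _ _ =
  let ij∈G , i∈S , j∈S = colex-restrict-pair V E s i j i<j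
                           (trans (≡.sym (adj-symmetrise-< (colexPairs V (E ⊓ C₂ s)) i<j)) ij∈H)
  in trans (adj-symmetrise-< (colexPairs V E) i<j) ij∈G , i∈S , j∈S
... | tri> _ _ j<i =
  let ji∈G , j∈S , i∈S = colex-restrict-pair V E s j i j<i
                           (trans (≡.sym (adj-symmetrise-> (colexPairs V (E ⊓ C₂ s)) j<i)) ij∈H)
  in trans (adj-symmetrise-> (colexPairs V E) j<i) ji∈G , i∈S , j∈S
... | tri≈ _ i≡j _ = ⊥-elim (adj⇒≢ (colex V (E ⊓ C₂ s)) ij∈H (Fin.toℕ-injective i≡j))

dens≤mad-colex : ∀ {V} E s → 1 ≤ s → s ≤ suc V → dens (E ⊓ C₂ s) s ℚ.≤ mad (colex (suc V) E)
dens≤mad-colex {V} E s 1≤s s≤V′ = subst₂ (λ a t → dens a t ℚ.≤ mad (colex (suc V) E)) edges size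
  (proj₁ (mad-isMad (colex (suc V) E)) (labelBelow (suc V) s) (colex (suc V) (E ⊓ C₂ s))
         (colex-restrict (suc V) E s) (subst (1 ≤_) (≡.sym size) 1≤s))
  where
  size : ∣ labelBelow (suc V) s ∣ ≡ s
  size = trans (∣labelBelow∣ (suc V) s) (ℕ.m≥n⇒m⊓n≡n s≤V′)
  edges : e (colex (suc V) (E ⊓ C₂ s)) ≡ E ⊓ C₂ s
  edges = trans (e-colex (suc V) (E ⊓ C₂ s))
                (ℕ.m≤n⇒m⊓n≡m (ℕ.≤-trans (ℕ.m⊓n≤n E (C₂ s)) (C₂-mono-≤ s≤V′)))

-- A subgraph of G on s vertices has at most E ⊓ C₂ s edges; for s ≤ suc V the colex graph has a
-- subgraph on s vertices with exactly that many, and larger s only lowers the density.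
isMad≤mad-colex : ∀ {v V} (G : Graph v) {m E} → IsMad G m → e G ≤ E → E ≤ C₂ (suc V) →
                  m ℚ.≤ mad (colex (suc V) E)
isMad≤mad-colex {V = V} G {m} {E} isMad eG≤E E≤C₂ =
  isMad-≤ G bound (isMad-nonneg (colex (suc V) E) (mad-isMad (colex (suc V) E))) isMad
  where
  bound : ∀ S H → IsSubgraph G S H → 1 ≤ ∣ S ∣ → dens (e H) ∣ S ∣ ℚ.≤ mad (colex (suc V) E)
  bound S H H⊆G 1≤∣S∣ with ℕ.≤-total ∣ S ∣ (suc V) | ℕ.≤-trans (isSubgraph⇒e≤e G H H⊆G) eG≤E
  ... | inj₁ ∣S∣≤V′ | eH≤E = ℚ.≤-trans (dens-mono-≤ ∣ S ∣ (ℕ.⊓-glb eH≤E (isSubgraph⇒e≤C₂ G H H⊆G)))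
                                       (dens≤mad-colex E ∣ S ∣ 1≤∣S∣ ∣S∣≤V′)
  ... | inj₂ V′≤∣S∣ | eH≤E = ℚ.≤-trans (dens-antitone (s≤s z≤n) V′≤∣S∣)
    (ℚ.≤-trans (dens-mono-≤ (suc V) (ℕ.⊓-glb eH≤E (ℕ.≤-trans eH≤E E≤C₂)))
               (dens≤mad-colex E (suc V) (s≤s z≤n) ℕ.≤-refl))

-- Colourings and partitions of E(Kₙ)

Colouring : ℕ → ℕ → Set
Colouring k n = Vec (Vec (Fin k) n) n

colour : ∀ {k n} → Colouring k n → Fin n → Fin n → Fin k
colour χ i j = lookup (lookup χ i) j

hasColour : ∀ {k n} → Colouring k n → Fin k → Fin n → Fin n → Bool
hasColour χ c i j = does (colour χ i j Fin.≟ c)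

colourClass : ∀ {k n} → Colouring k n → Fin k → Graph n
colourClass χ c = symmetrise (hasColour χ c)

colourClass-partition-< : ∀ {k n} (χ : Colouring k n) {i j} → toℕ i < toℕ j →
  (Σ (Fin k) λ c → adj (colourClass χ c) i j ≡ true) ×
  (∀ c c′ → adj (colourClass χ c) i j ≡ true → adj (colourClass χ c′) i j ≡ true → c ≡ c′)
colourClass-partition-< χ {i} {j} i<j =
  (colour χ i j , trans (adj-symmetrise-< (hasColour χ (colour χ i j)) i<j)
                        (dec-true (colour χ i j Fin.≟ colour χ i j) refl)) ,
  λ c c′ ij∈c ij∈c′ → trans (≡.sym (coloured c ij∈c)) (coloured c′ ij∈c′)
  where
  coloured : ∀ c → adj (colourClass χ c) i j ≡ true → colour χ i j ≡ c
  coloured c ij∈c with colour χ i j Fin.≟ c | trans (≡.sym (adj-symmetrise-< (hasColour χ c) i<j)) ij∈c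
  ... | yes ij↦c | _  = ij↦c
  ... | no  _    | ()

colourClass-partition : ∀ {k n} (χ : Colouring k n) → IsPartitionKn k n (colourClass χ)
colourClass-partition χ i j i≢j with ℕ.<-cmp (toℕ i) (toℕ j)
... | tri< i<j _ _ = colourClass-partition-< χ i<j
... | tri> _ _ j<i =
  let (c , ji∈c) , unique = colourClass-partition-< χ j<i
  in (c , trans (sym (colourClass χ c) i j) ji∈c) ,
     λ c c′ ij∈c ij∈c′ → unique c c′ (trans (sym (colourClass χ c) j i) ij∈c)
                                     (trans (sym (colourClass χ c′) j i) ij∈c′)
... | tri≈ _ i≡j _ = ⊥-elim (i≢j (Fin.toℕ-injective i≡j))

ℕΣ-oneHot : ∀ {k} (x : Fin k) b → ℕΣ.sum (λ c → 𝟙 (does (x Fin.≟ c) ∧ b)) ≡ 𝟙 b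
ℕΣ-oneHot {suc k} fzero    b = trans (cong (𝟙 b +_) (ℕΣ.sum-replicate-zero k)) (ℕ.+-identityʳ (𝟙 b))
ℕΣ-oneHot         (fsuc x) b = ℕΣ-oneHot x b

edgeCount-colourClasses : ∀ {k n} (χ : Colouring k n) → ℕΣ.sum (λ c → e (colourClass χ c)) ≡ C₂ n
edgeCount-colourClasses {k} {n} χ = begin
  ℕΣ.sum (λ c → e (colourClass χ c))
    ≡⟨ ℕΣ.sum-cong-≗ {k} (λ c → e-symmetrise (hasColour χ c)) ⟩
  ℕΣ.sum (λ c → ℕΣ.sum (λ i → ℕΣ.sum (λ j → inClass c i j)))
    ≡⟨ ℕΣ.∑-comm (λ c i → ℕΣ.sum (λ j → inClass c i j)) ⟩
  ℕΣ.sum (λ i → ℕΣ.sum (λ c → ℕΣ.sum (λ j → inClass c i j)))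
    ≡⟨ ℕΣ.sum-cong-≗ {n} (λ i → ℕΣ.∑-comm (λ c j → inClass c i j)) ⟩
  ℕΣ.sum (λ i → ℕΣ.sum (λ j → ℕΣ.sum (λ c → inClass c i j)))
    ≡⟨ ℕΣ.sum-cong-≗ {n} (λ i → ℕΣ.sum-cong-≗ {n} (λ j → ℕΣ-oneHot (colour χ i j) (toℕ i <ᵇ toℕ j))) ⟩
  edgeCount {n} (λ _ _ → true)
    ≡⟨ edgeCount-complete n ⟩
  C₂ n ∎
  where
  open ≡-Reasoning
  inClass : Fin k → Fin n → Fin n → ℕ
  inClass c i j = 𝟙 (hasColour χ c i j ∧ (toℕ i <ᵇ toℕ j))

module _ {k n} (Gs : Fin (suc k) → Graph n) (partition : IsPartitionKn (suc k) n Gs) where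

  partitionColour : Fin n → Fin n → Fin (suc k)
  partitionColour i j with i Fin.≟ j
  ... | yes _   = fzero
  ... | no i≢j = proj₁ (proj₁ (partition i j i≢j))

  partitionColour-spec : ∀ {i j} → i ≢ j → ∀ c → does (partitionColour i j Fin.≟ c) ≡ adj (Gs c) i j
  partitionColour-spec {i} {j} i≢j c with i Fin.≟ j
  ... | yes i≡j = ⊥-elim (i≢j i≡j)
  ... | no i≢j′ with proj₁ (partition i j i≢j′) | proj₂ (partition i j i≢j′)
  ...   | c₀ , ij∈c₀ | unique with c₀ Fin.≟ c
  ...     | yes refl = ≡.sym ij∈c₀
  ...     | no c₀≢c  = ≡.sym (Bool.¬-not (λ ij∈c → c₀≢c (unique c₀ c ij∈c₀ ij∈c)))

  partitionColouring : Colouring (suc k) n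
  partitionColouring = Vec.tabulate (λ i → Vec.tabulate (partitionColour i))

  hasColour-partitionColouring : ∀ {i j} → i ≢ j → ∀ c → hasColour partitionColouring c i j ≡ adj (Gs c) i j
  hasColour-partitionColouring {i} {j} i≢j c = trans
    (cong (λ x → does (x Fin.≟ c))
          (trans (cong (λ row → lookup row j) (Vec.lookup∘tabulate _ i)) (Vec.lookup∘tabulate _ j)))
    (partitionColour-spec i≢j c)

  adj-partitionColouring : ∀ c i j → adj (colourClass partitionColouring c) i j ≡ adj (Gs c) i j
  adj-partitionColouring c i j with ℕ.<-cmp (toℕ i) (toℕ j)
  ... | tri< i<j i≢j _ = trans (adj-symmetrise-< (hasColour partitionColouring c) i<j)
                               (hasColour-partitionColouring (i≢j ∘ cong toℕ) c)
  ... | tri> _ j≢i j<i = trans (adj-symmetrise-> (hasColour partitionColouring c) j<i)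
    (trans (hasColour-partitionColouring (j≢i ∘ cong toℕ ∘ ≡.sym) c) (sym (Gs c) j i))
  ... | tri≈ _ i≡j _ rewrite Fin.toℕ-injective {i = i} {j} i≡j =
    trans (irrefl (colourClass partitionColouring c) j) (≡.sym (irrefl (Gs c) j))

  partition-edges : ℕΣ.sum (λ c → e (Gs c)) ≡ C₂ n
  partition-edges = trans
    (ℕΣ.sum-cong-≗ {suc k} λ c →
      ≡.sym (e-cong (colourClass partitionColouring c) (Gs c) (adj-partitionColouring c)))
    (edgeCount-colourClasses partitionColouring)

-- M(k,n) and Mᴸ(k,N)

isMadSum-≤ : ∀ {k} (Gs : Fin k → AnyGraph) {s} (b : Fin k → ℚ) →
  (∀ j {m} → IsMad (proj₂ (Gs j)) m → m ℚ.≤ b j) → IsMadSum k Gs s → s ℚ.≤ ℚΣ.sum b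
isMadSum-≤ {k} Gs b bound (ms , isMads , refl) =
  subst (ℚ._≤ ℚΣ.sum b) (≡.sym (sumQ≡sum k ms)) (ℚΣ-mono-≤ (λ j → bound j (isMads j)))

M-exists : ∀ {k n} → 1 ≤ k → 1 ≤ n → Σ ℚ (IsM k n)
M-exists {suc k} {suc n} _ _ =
  value χ* ,
  (colourClass χ* , colourClass-partition χ* ,
   (λ c → mad (colourClass χ* c)) , (λ c → mad-isMad (colourClass χ* c)) ,
   ≡.sym (sumQ≡sum (suc k) (λ c → mad (colourClass χ* c)))) ,
  bound
  where
  value : Colouring (suc k) (suc n) → ℚ
  value χ = ℚΣ.sum (λ c → mad (colourClass χ c))
  best = maximiser U? value (vectors-enumerates (vectors-enumerates ∈-allFin))
           (Vec.replicate (suc n) (Vec.replicate (suc n) fzero)) _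
  χ* = proj₁ best
  bound : ∀ Gs s → IsPartitionKn (suc k) (suc n) Gs → IsMadSum (suc k) (asAny Gs) s → s ℚ.≤ value χ*
  bound Gs s partition isMadSum = ℚ.≤-trans
    (isMadSum-≤ (asAny Gs) (λ c → mad (colourClass χ c))
      (λ c isMad → isMad-mono (Gs c) (colourClass χ c)
                     (λ i j ij∈c → trans (adj-partitionColouring Gs partition c i j) ij∈c)
                     isMad (mad-isMad (colourClass χ c)))
      isMadSum)
    (proj₂ (proj₂ best) χ _)
    where χ = partitionColouring Gs partition

-- The parts of a composition are stored in Fin (suc N) so that there are finitely many.
Composition : ℕ → ℕ → Set
Composition k N = Vec (Fin (suc N)) k

part : ∀ {k N} → Composition k N → Fin k → ℕ
part E j = toℕ (lookup E j)

part≤N : ∀ {k N} (E : Composition k N) j → part E j ≤ N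
part≤N E j = ℕ.s≤s⁻¹ (Fin.toℕ<n (lookup E j))

toComposition : ∀ {k N} (f : Fin k → ℕ) → ℕΣ.sum f ≡ N → Composition k N
toComposition f Σf≡N = Vec.tabulate (λ j → Fin.fromℕ< (s≤s (subst (f j ≤_) Σf≡N (≤-sum f j))))

part-toComposition : ∀ {k N} (f : Fin k → ℕ) (Σf≡N : ℕΣ.sum f ≡ N) j → part (toComposition f Σf≡N) j ≡ f j
part-toComposition f Σf≡N j = trans (cong toℕ (Vec.lookup∘tabulate _ j)) (Fin.toℕ-fromℕ< _)

onePart : ∀ k N → Composition (suc k) N
onePart k N = Fin.fromℕ N ∷ Vec.replicate k fzero

sum-onePart : ∀ k N → ℕΣ.sum (part (onePart k N)) ≡ N
sum-onePart k N = trans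
  (cong₂ _+_ (Fin.toℕ-fromℕ N) (trans (ℕΣ.sum-cong-≗ {k} (λ j → cong toℕ (Vec.lookup-replicate j fzero)))
                                      (ℕΣ.sum-replicate-zero k)))
  (ℕ.+-identityʳ N)

ML-exists : ∀ {k} N → 1 ≤ k → Σ ℚ (IsML k N)
ML-exists {suc k} N _ =
  value E* ,
  ((λ j → suc N , colex (suc N) (part E* j)) , edges ,
   (λ j → mad (colex (suc N) (part E* j))) , (λ j → mad-isMad (colex (suc N) (part E* j))) ,
   ≡.sym (sumQ≡sum (suc k) (λ j → mad (colex (suc N) (part E* j))))) ,
  bound
  where
  value : Composition (suc k) N → ℚ
  value E = ℚΣ.sum (λ j → mad (colex (suc N) (part E j)))
  best = maximiser (λ E → ℕΣ.sum (part E) ℕ.≟ N) value (vectors-enumerates ∈-allFin)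
           (onePart k N) (sum-onePart k N)
  E* = proj₁ best
  N≤C₂ : N ≤ C₂ (suc N)
  N≤C₂ = ℕ.m≤m+n N (C₂ N)
  edges : sumFin (suc k) (λ j → e (colex (suc N) (part E* j))) ≡ N
  edges = trans (sumFin≡sum (suc k) (λ j → e (colex (suc N) (part E* j)))) (trans
    (ℕΣ.sum-cong-≗ {suc k} (λ j → trans (e-colex (suc N) (part E* j))
                                         (ℕ.m≤n⇒m⊓n≡m (ℕ.≤-trans (part≤N E* j) N≤C₂))))
    (proj₁ (proj₂ best)))
  bound : ∀ Gs s → sumFin (suc k) (λ j → e (proj₂ (Gs j))) ≡ N → IsMadSum (suc k) Gs s → s ℚ.≤ value E*
  bound Gs s size isMadSum = ℚ.≤-trans
    (isMadSum-≤ Gs (λ j → mad (colex (suc N) (part E j)))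
      (λ j isMad → isMad≤mad-colex (proj₂ (Gs j)) isMad (ℕ.≤-reflexive (≡.sym (part-E j)))
                                    (ℕ.≤-trans (part≤N E j) N≤C₂))
      isMadSum)
    (proj₂ (proj₂ best) E (trans (ℕΣ.sum-cong-≗ {suc k} part-E) sizes))
    where
    edgesOf : Fin (suc k) → ℕ
    edgesOf j = e (proj₂ (Gs j))
    sizes : ℕΣ.sum edgesOf ≡ N
    sizes = trans (≡.sym (sumFin≡sum (suc k) edgesOf)) size
    E = toComposition edgesOf sizes
    part-E = part-toComposition edgesOf sizes

isM≤isML : ∀ {k n m mL} → 1 ≤ k → IsM k n m → IsML k (C₂ n) mL → m ℚ.≤ mL
isM≤isML {suc k} {n} {m} _ ((Gs , partition , isMadSum) , _) (_ , ML-bound) =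
  ML-bound (asAny Gs) m (trans (sumFin≡sum (suc k) (λ c → e (Gs c))) (partition-edges Gs partition))
           isMadSum

-- (Σ m)² ≤ k Σ m² ≤ k (2N - Σ m) by Cauchy–Schwarz and isMad-sq.
isMadSum-sq< : ∀ {k N} (Gs : Fin k → AnyGraph) {s} → IsMadSum k Gs s →
  sumFin k (λ j → e (proj₂ (Gs j))) ≡ N → 1 ≤ k → 1 ≤ N → s ℚ.* s ℚ.< fromℕ (2 * k * N)
isMadSum-sq< {k} {N} Gs (ms , isMads , refl) size 1≤k 1≤N rewrite sumQ≡sum k ms =
  x*x+c*x≤y⇒x*x<y 0≤S (0<fromℕ 1≤k) (0<fromℕ 1≤2kN) (begin
    S ℚ.* S ℚ.+ fromℕ k ℚ.* S               ≤⟨ ℚ.+-monoˡ-≤ (fromℕ k ℚ.* S) (cauchy-schwarz ms) ⟩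
    fromℕ k ℚ.* Q ℚ.+ fromℕ k ℚ.* S         ≡⟨ ℚ.*-distribˡ-+ (fromℕ k) Q S ⟨
    fromℕ k ℚ.* (Q ℚ.+ S)                   ≤⟨ ℚ.*-monoˡ-≤-nonNeg (fromℕ k) {{k≥0}} Q+S≤2N ⟩
    fromℕ k ℚ.* fromℕ (2 * N)               ≡⟨ fromℕ-* k (2 * N) ⟨
    fromℕ (k * (2 * N))                     ≡⟨ cong fromℕ (reorder k N) ⟩
    fromℕ (2 * k * N)                       ∎)
  where
  open ℚ.≤-Reasoning
  S = ℚΣ.sum ms
  Q = ℚΣ.sum (λ j → ms j ℚ.* ms j)
  edgesOf : Fin k → ℕ
  edgesOf j = e (proj₂ (Gs j))
  ΣedgesOf≡N : ℕΣ.sum edgesOf ≡ N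
  ΣedgesOf≡N = trans (≡.sym (sumFin≡sum k edgesOf)) size
  0≤S : ℚ.0ℚ ℚ.≤ S
  0≤S = subst (ℚ._≤ S) (ℚΣ.sum-replicate-zero k) (ℚΣ-mono-≤ (λ j → isMad-nonneg (proj₂ (Gs j)) (isMads j)))
  Q+S≤2N : Q ℚ.+ S ℚ.≤ fromℕ (2 * N)
  Q+S≤2N = begin
    Q ℚ.+ S                                  ≡⟨ ℚΣ.∑-distrib-+ (λ j → ms j ℚ.* ms j) ms ⟨
    ℚΣ.sum (λ j → ms j ℚ.* ms j ℚ.+ ms j)    ≤⟨ ℚΣ-mono-≤ (λ j → isMad-sq (proj₂ (Gs j)) (isMads j)) ⟩
    ℚΣ.sum (λ j → fromℕ (2 * edgesOf j))    ≡⟨ fromℕ-sum (λ j → 2 * edgesOf j) ⟨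
    fromℕ (ℕΣ.sum (λ j → 2 * edgesOf j))    ≡⟨ cong fromℕ (ℕΣ.*-distribˡ-sum 2 edgesOf) ⟨
    fromℕ (2 * ℕΣ.sum edgesOf)              ≡⟨ cong (λ x → fromℕ (2 * x)) ΣedgesOf≡N ⟩
    fromℕ (2 * N)                            ∎
  k≥0 = ℚ.nonNegative (ℚ.<⇒≤ (0<fromℕ 1≤k))
  1≤2kN : 1 ≤ 2 * k * N
  1≤2kN = ℕ.*-mono-≤ {1} {2 * k} {1} {N} (ℕ.*-mono-≤ {1} {2} {1} {k} (s≤s z≤n) 1≤k) 1≤N
  reorder : ∀ k N → k * (2 * N) ≡ 2 * k * N
  reorder = solve-∀

corollary3p10 : ∀ (n k : ℕ) → 2 ≤ n → 1 ≤ k → k ≤ n C 2 →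
    Σ ℚ λ m → Σ ℚ λ mL →
      IsM k n m × IsML k (n C 2) mL
      × m ℚ.≤ mL
      × LtSqrt mL (2 * k * (n C 2))
      × (2 * k * (n C 2) < k * (n * n))
corollary3p10 n k 2≤n 1≤k _ rewrite C≡C₂ n =
  let m  , isM  = M-exists 1≤k 1≤n
      mL , isML = ML-exists (C₂ n) 1≤k
      (family , size , isMadSum) , _ = isML
  in m , mL , isM , isML , isM≤isML 1≤k isM isML ,
     inj₂ (isMadSum-sq< family isMadSum size 1≤k (C₂-mono-≤ 2≤n)) ,
     2kC₂n<kn² 1≤k 1≤n
  where
  1≤n : 1 ≤ n
  1≤n = ℕ.≤-trans (s≤s z≤n) 2≤n
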